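{- Let $(a_j)_{j\ge 1}$ be the strictly increasing enumeration of the positive integers that are simultaneously triangular and square, i.e. of the positive integers $a$ for which there exist positive integers $m,n$ with $a=n^2=\frac{m(m+1)}{2}$ (so $a_1=1$, $a_2=36$, $a_3=1225$, $a_4=41616,\dots$). For $j\ge 2$ define $$b_j=\frac{a_{j+1}}{a_j}-\frac{a_j}{a_{j-1}}.$$ Then $$\lim_{j\to+\infty}\frac{b_{j-1}}{b_j}=(1+\sqrt{2})^4=17+12\sqrt{2}.$$
   Context: A non-negative integer is triangular if it equals $T_m=\frac{m(m+1)}{2}$ for some natural number $m$, and square if it equals $n^2$ for some natural number $n$. -}

module Defs where

open import Data.Nat as ℕ using (ℕ; zero; suc)
open import Data.Integer as ℤ using (+_)
open import Data.Rational as ℚ using (ℚ; 0ℚ; _÷_; _-_; _*_; _<_; ≢-nonZero)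
open import Data.Rational.Properties using (_≟_)
open import Data.Product using (Σ; _×_; ∃-syntax)
open import Data.Sum using (_⊎_)
open import Relation.Nullary using (yes; no)
open import Relation.Binary.PropositionalEquality using (_≡_)

TriSq : ℕ → Set
TriSq a = ∃[ m ] ∃[ n ] (1 ℕ.≤ m × 1 ℕ.≤ n × a ≡ n ℕ.* n × 2 ℕ.* a ≡ m ℕ.* (m ℕ.+ 1))

-- a : ℕ → ℕ is the strictly increasing enumeration (a_1, a_2, ...) of the
-- triangular-square positive integers (index 0 is unused).
IsTriSqEnum : (ℕ → ℕ) → Set
IsTriSqEnum a =
  ((i j : ℕ) → 1 ℕ.≤ i → i ℕ.< j → a i ℕ.< a j) ×
  ((j : ℕ) → 1 ℕ.≤ j → TriSq (a j)) ×
  ((x : ℕ) → TriSq x → ∃[ j ] (1 ℕ.≤ j × a j ≡ x))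

-- p / q as a rational (junk value 0 when q = 0; never used since a_j > 0).
ratio : ℕ → ℕ → ℚ
ratio p zero = 0ℚ
ratio p (suc q) = + p ℚ./ suc q

-- x / y in ℚ (junk value 0 when y = 0).
qdiv : ℚ → ℚ → ℚ
qdiv x y with y ≟ 0ℚ
... | yes _ = 0ℚ
... | no y≢0 = _÷_ x y {{≢-nonZero y≢0}}

b : (ℕ → ℕ) → ℕ → ℚ
b a j = ratio (a (suc j)) (a j) - ratio (a j) (a (j ℕ.∸ 1))

-- The real number L = 17 + 12√2 = (1+√2)^4 is irrational; comparisons of a
-- rational q with L are written out exactly: with s = q - 17,
--   q < L  iff  s < 12√2  iff  s < 0 or s² < 288,
--   L < q  iff  12√2 < s  iff  s > 0 and s² > 288.
fromℕ : ℕ → ℚ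
fromℕ k = + k ℚ./ 1

BelowL : ℚ → Set
BelowL q = (q - fromℕ 17 < 0ℚ) ⊎ ((q - fromℕ 17) * (q - fromℕ 17) < fromℕ 288)

AboveL : ℚ → Set
AboveL q = (0ℚ < q - fromℕ 17) × (fromℕ 288 < (q - fromℕ 17) * (q - fromℕ 17))

WithinOfL : ℚ → ℚ → Set
WithinOfL ε x = BelowL (x - ε) × AboveL (x ℚ.+ ε)

ConvergesToL : (ℕ → ℚ) → Set
ConvergesToL s = (ε : ℚ) → 0ℚ < ε → ∃[ N ] ((j : ℕ) → N ℕ.≤ j → WithinOfL ε (s j))

-- Triangular squares a = n² = m(m + 1)/2 are the solutions of the Pell equation
-- (2m + 1)² − 2(2n)² = 1: they are generated from (0, 0) by the unit 3 + 2√2, and every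
-- solution descends to a smaller one, so aⱼ = nⱼ² for the j-th solution.  These satisfy
-- aⱼ₋₁ + aⱼ₊₁ = 34aⱼ + 2 and conserve aⱼ² + aⱼ₊₁² + 1 = 34aⱼaⱼ₊₁ + 2(aⱼ + aⱼ₊₁), whence
-- aⱼ₋₁aⱼ₊₁ = (aⱼ − 1)², bⱼ = −(2aⱼ − 1)/(aⱼ₋₁aⱼ) and bⱼ₋₁/bⱼ = u/v with u = (2aⱼ₋₁ − 1)aⱼ and
-- v = (2aⱼ − 1)aⱼ₋₂.  Modulo the conserved form, u² − 34uv + v² is a nonnegative cubic in
-- aⱼ₋₁, aⱼ while v² is quartic, so u/v > 17 is a root of t² − 34t + 1 up to O(1/aⱼ), hence
-- close to its larger root 17 + 12√2.

module Submission where

open import Defs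
open import Data.Nat using (ℕ)

module TriangularSquares where

  open import Data.Nat
  open import Data.Nat.Induction using (<-wellFounded; <-rec)
  open import Data.Nat.Properties
  open import Data.Nat.Tactic.RingSolver using (solve-∀)
  open import Data.Product using (_×_; _,_; proj₁; proj₂; ∃-syntax; uncurry)
  open import Data.Sum using (inj₁; inj₂)
  open import Induction.WellFounded using (Acc; acc)
  open import Relation.Binary using (_Preserves_⟶_; tri<; tri≈; tri>)
  open import Relation.Binary.PropositionalEquality
  open import Relation.Nullary using (contradiction)

  SquareTriangle : ℕ → ℕ → Set
  SquareTriangle m n = 2 * (n * n) ≡ m * (m + 1)

  -- (2m + 1) + 2n√2 ↦ (3 + 2√2)((2m + 1) + 2n√2)
  grow : ℕ × ℕ → ℕ × ℕ
  grow (m , n) = 3 * m + 4 * n + 1 , 2 * m + 3 * n + 1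

  +-cancelʳ-equal : ∀ {a b c d} → a + c ≡ b + d → c ≡ d → a ≡ b
  +-cancelʳ-equal {a} {b} {c} eq refl = +-cancelʳ-≡ c a b eq

  +-cancelˡ-equal : ∀ {a b c d} → a + c ≡ b + d → a ≡ b → c ≡ d
  +-cancelˡ-equal {a} {b} {c} {d} eq refl = +-cancelˡ-≡ a c d eq

  grow-preserves-defect : ∀ m n → 2 * ((2 * m + 3 * n + 1) * (2 * m + 3 * n + 1)) + m * (m + 1)
                      ≡ (3 * m + 4 * n + 1) * (3 * m + 4 * n + 1 + 1) + 2 * (n * n)
  grow-preserves-defect = solve-∀

  grow-preserves : ∀ {m n} → SquareTriangle m n → uncurry SquareTriangle (grow (m , n))
  grow-preserves {m} {n} eq = +-cancelʳ-equal (grow-preserves-defect m n) (sym eq)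

  grow-reflects : ∀ {m n} → uncurry SquareTriangle (grow (m , n)) → SquareTriangle m n
  grow-reflects {m} {n} eq = sym (+-cancelˡ-equal (grow-preserves-defect m n) eq)

  m*m≤n*n⇒m≤n : ∀ {a b} → a * a ≤ b * b → a ≤ b
  m*m≤n*n⇒m≤n {a} {b} le = ≮⇒≥ λ b<a → <⇒≱ (*-mono-< b<a b<a) le

  2m+1≤3n : ∀ {m n} → SquareTriangle (suc m) n → 2 * suc m + 1 ≤ 3 * n
  2m+1≤3n {m} {n} eq = m*m≤n*n⇒m≤n (*-cancelˡ-≤ 2 (begin
    2 * (M * M)                   ≤⟨ m≤m+n _ (m * m + 3 * m) ⟩
    2 * (M * M) + (m * m + 3 * m) ≡⟨ lhs m ⟩
    9 * (suc m * (suc m + 1))     ≡⟨ cong (9 *_) eq ⟨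
    9 * (2 * (n * n))             ≡⟨ rhs n ⟩
    2 * (3 * n * (3 * n))         ∎))
    where
    open ≤-Reasoning
    M = 2 * suc m + 1
    lhs : ∀ m → 2 * ((2 * suc m + 1) * (2 * suc m + 1)) + (m * m + 3 * m) ≡ 9 * (suc m * (suc m + 1))
    lhs = solve-∀
    rhs : ∀ n → 9 * (2 * (n * n)) ≡ 2 * (3 * n * (3 * n))
    rhs = solve-∀

  4n≤3m+1 : ∀ {m n} → SquareTriangle (suc m) n → 4 * n ≤ 3 * suc m + 1
  4n≤3m+1 {m} {n} eq = m*m≤n*n⇒m≤n (begin
    4 * n * (4 * n)                   ≡⟨ lhs n ⟩
    8 * (2 * (n * n))                 ≡⟨ cong (8 *_) eq ⟩
    8 * (suc m * (suc m + 1))         ≤⟨ m≤m+n _ (m * m) ⟩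
    8 * (suc m * (suc m + 1)) + m * m ≡⟨ rhs m ⟩
    (3 * suc m + 1) * (3 * suc m + 1) ∎)
    where
    open ≤-Reasoning
    lhs : ∀ n → 4 * n * (4 * n) ≡ 8 * (2 * (n * n))
    lhs = solve-∀
    rhs : ∀ m → 8 * (suc m * (suc m + 1)) + m * m ≡ (3 * suc m + 1) * (3 * suc m + 1)
    rhs = solve-∀

  grow-inverse : ∀ {m n m₀ n₀} → 4 * n + m₀ ≡ 3 * m + 1 → 2 * m + 1 + n₀ ≡ 3 * n →
                 grow (m₀ , n₀) ≡ (m , n)
  grow-inverse {m} {n} {m₀} {n₀} e₁ e₂ = cong₂ _,_
    (+-cancelʳ-≡ (12 * n + 8 * m + 3) _ _ (begin
      3 * m₀ + 4 * n₀ + 1 + (12 * n + 8 * m + 3) ≡⟨ lhs₁ m n m₀ n₀ ⟩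
      3 * (4 * n + m₀) + 4 * (2 * m + 1 + n₀)    ≡⟨ cong₂ (λ a b → 3 * a + 4 * b) e₁ e₂ ⟩
      3 * (3 * m + 1) + 4 * (3 * n)              ≡⟨ rhs₁ m n ⟩
      m + (12 * n + 8 * m + 3)                   ∎))
    (+-cancelʳ-≡ (8 * n + 6 * m + 2) _ _ (begin
      2 * m₀ + 3 * n₀ + 1 + (8 * n + 6 * m + 2) ≡⟨ lhs₂ m n m₀ n₀ ⟩
      2 * (4 * n + m₀) + 3 * (2 * m + 1 + n₀)   ≡⟨ cong₂ (λ a b → 2 * a + 3 * b) e₁ e₂ ⟩
      2 * (3 * m + 1) + 3 * (3 * n)             ≡⟨ rhs₂ m n ⟩
      n + (8 * n + 6 * m + 2)                   ∎))
    where
    open ≡-Reasoning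
    lhs₁ : ∀ m n m₀ n₀ → 3 * m₀ + 4 * n₀ + 1 + (12 * n + 8 * m + 3) ≡ 3 * (4 * n + m₀) + 4 * (2 * m + 1 + n₀)
    lhs₁ = solve-∀
    rhs₁ : ∀ m n → 3 * (3 * m + 1) + 4 * (3 * n) ≡ m + (12 * n + 8 * m + 3)
    rhs₁ = solve-∀
    lhs₂ : ∀ m n m₀ n₀ → 2 * m₀ + 3 * n₀ + 1 + (8 * n + 6 * m + 2) ≡ 2 * (4 * n + m₀) + 3 * (2 * m + 1 + n₀)
    lhs₂ = solve-∀
    rhs₂ : ∀ m n → 2 * (3 * m + 1) + 3 * (3 * n) ≡ n + (8 * n + 6 * m + 2)
    rhs₂ = solve-∀

  squareTriangle-descent : ∀ {m n} → SquareTriangle (suc m) n → ∃[ p ] grow p ≡ (suc m , n)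
  squareTriangle-descent {m} {n} eq = descend (m≤n⇒∃[o]m+o≡n (4n≤3m+1 {m} {n} eq))
                                              (m≤n⇒∃[o]m+o≡n (2m+1≤3n {m} {n} eq))
    where
    descend : ∃[ m₀ ] 4 * n + m₀ ≡ 3 * suc m + 1 → ∃[ n₀ ] 2 * suc m + 1 + n₀ ≡ 3 * n →
              ∃[ p ] grow p ≡ (suc m , n)
    descend (m₀ , e₁) (n₀ , e₂) = (m₀ , n₀) , grow-inverse e₁ e₂

  <-grow : ∀ m n → n < proj₂ (grow (m , n))
  <-grow m n = ≤-trans (m≤m+n (suc n) (2 * m + 2 * n)) (≤-reflexive (shuffle m n))
    where
    shuffle : ∀ m n → suc n + (2 * m + 2 * n) ≡ 2 * m + 3 * n + 1
    shuffle = solve-∀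

  solution : ℕ → ℕ × ℕ
  solution zero = 0 , 0
  solution (suc k) = grow (solution k)

  solution-squareTriangle : ∀ k → uncurry SquareTriangle (solution k)
  solution-squareTriangle zero = refl
  solution-squareTriangle (suc k) =
    grow-preserves {proj₁ (solution k)} {proj₂ (solution k)} (solution-squareTriangle k)

  solution-complete : ∀ {m n} → SquareTriangle m n → ∃[ k ] solution k ≡ (m , n)
  solution-complete = go (<-wellFounded _)
    where
    go : ∀ {m n} → Acc _<_ n → SquareTriangle m n → ∃[ k ] solution k ≡ (m , n)
    go {zero} {zero} _ _ = 0 , refl
    go {zero} {suc n} _ ()
    go {suc m} {n} (acc rec) eq = step (squareTriangle-descent {m} {n} eq)
      where
      step : ∃[ p ] grow p ≡ (suc m , n) → ∃[ k ] solution k ≡ (suc m , n)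
      step ((m₀ , n₀) , grown) =
        let k , sol = go {m₀} {n₀} (rec (subst (n₀ <_) (cong proj₂ grown) (<-grow m₀ n₀)))
                         (grow-reflects {m₀} {n₀} (subst (uncurry SquareTriangle) (sym grown) eq))
        in suc k , trans (cong grow sol) grown

  -- Kept opaque so that unification treats triSq k as rigid.
  opaque
    triSq : ℕ → ℕ
    triSq k = proj₂ (solution k) * proj₂ (solution k)

    triSq-zero : triSq 0 ≡ 0
    triSq-zero = refl

    triSq-one : triSq 1 ≡ 1
    triSq-one = refl

    triSq-recurrence : ∀ k → triSq k + triSq (2 + k) ≡ 34 * triSq (1 + k) + 2
    triSq-recurrence k = +-cancelʳ-equal (identity (proj₁ (solution k)) (proj₂ (solution k)))
                                         (cong (8 *_) (solution-squareTriangle k))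
      where
      identity : ∀ m n →
        let n₁ = 2 * m + 3 * n + 1 ; n₂ = 2 * (3 * m + 4 * n + 1) + 3 * n₁ + 1 in
        n * n + n₂ * n₂ + 8 * (2 * (n * n)) ≡ 34 * (n₁ * n₁) + 2 + 8 * (m * (m + 1))
      identity = solve-∀

    triSq-TriSq : ∀ k → TriSq (triSq (suc k))
    triSq-TriSq k = proj₁ (solution (suc k)) , proj₂ (solution (suc k)) , m≤n+m 1 _ , m≤n+m 1 _ , refl
                  , solution-squareTriangle (suc k)

    TriSq⇒triSq : ∀ {a} → TriSq a → ∃[ k ] triSq (suc k) ≡ a
    TriSq⇒triSq {a} (m , n , _ , 1≤n , a≡n² , 2a≡m[m+1]) =
      index (solution-complete (trans (cong (2 *_) (sym a≡n²)) 2a≡m[m+1]))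
      where
      index : ∃[ k ] solution k ≡ (m , n) → ∃[ k ] triSq (suc k) ≡ a
      index (zero , sol) = contradiction (cong proj₂ sol) (<⇒≢ 1≤n)
      index (suc k , sol) = k , trans (cong (λ p → proj₂ p * proj₂ p) sol) (sym a≡n²)

  triSq-grows : ∀ k → 17 * triSq k < triSq (suc k)
  triSq-grows zero = subst₂ (λ t₀ t₁ → 17 * t₀ < t₁) (sym triSq-zero) (sym triSq-one) (s≤s z≤n)
  triSq-grows (suc k) = +-cancelˡ-< (triSq k) _ _ (begin-strict
    triSq k + 17 * triSq (1 + k)       <⟨ +-monoˡ-< (17 * triSq (1 + k)) (≤-<-trans (m≤n*m (triSq k) 17) (triSq-grows k)) ⟩
    triSq (1 + k) + 17 * triSq (1 + k) ≡⟨ double (triSq (1 + k)) ⟩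
    18 * triSq (1 + k)                 ≤⟨ *-monoˡ-≤ (triSq (1 + k)) (m≤m+n 18 16) ⟩
    34 * triSq (1 + k)                 ≤⟨ m≤m+n _ 2 ⟩
    34 * triSq (1 + k) + 2             ≡⟨ triSq-recurrence k ⟨
    triSq k + triSq (2 + k)            ∎)
    where
    open ≤-Reasoning
    double : ∀ t → t + 17 * t ≡ 18 * t
    double = solve-∀

  triSq-< : ∀ k → triSq k < triSq (suc k)
  triSq-< k = ≤-<-trans (m≤n*m (triSq k) 17) (triSq-grows k)

  triSq-positive : ∀ k → 1 ≤ triSq (suc k)
  triSq-positive k = ≤-<-trans z≤n (triSq-grows k)

  triSq-≤-36* : ∀ k → triSq (2 + k) ≤ 36 * triSq (1 + k)
  triSq-≤-36* k = begin
    triSq (2 + k)                          ≤⟨ m≤n+m _ (triSq k) ⟩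
    triSq k + triSq (2 + k)                ≡⟨ triSq-recurrence k ⟩
    34 * triSq (1 + k) + 2                 ≤⟨ +-monoʳ-≤ (34 * triSq (1 + k)) (*-monoʳ-≤ 2 (triSq-positive k)) ⟩
    34 * triSq (1 + k) + 2 * triSq (1 + k) ≡⟨ collect (triSq (1 + k)) ⟩
    36 * triSq (1 + k)                     ∎
    where
    open ≤-Reasoning
    collect : ∀ t → 34 * t + 2 * t ≡ 36 * t
    collect = solve-∀

  k≤triSq : ∀ k → k ≤ triSq k
  k≤triSq zero = z≤n
  k≤triSq (suc k) = ≤-<-trans (k≤triSq k) (triSq-< k)

  triSq-mono-< : triSq Preserves _<_ ⟶ _<_
  triSq-mono-< {i} {suc j} (s≤s i≤j) with m≤n⇒m<n∨m≡n i≤j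
  ... | inj₁ i<j = <-trans (triSq-mono-< i<j) (triSq-< j)
  ... | inj₂ refl = triSq-< j

  enumeration-≤ : ∀ {f g : ℕ → ℕ} → f Preserves _<_ ⟶ _<_ → g Preserves _<_ ⟶ _<_ →
                  ∀ i → (∀ {j} → j < i → f j ≡ g j) → ∃[ j ] g j ≡ f i → g i ≤ f i
  enumeration-≤ {f} {g} f-mono g-mono i agree (j , gj≡fi) with <-cmp j i
  ... | tri< j<i _ _ = contradiction (trans (agree j<i) gj≡fi) (<⇒≢ (f-mono j<i))
  ... | tri≈ _ refl _ = ≤-reflexive gj≡fi
  ... | tri> _ _ i<j = <⇒≤ (subst (g i <_) gj≡fi (g-mono i<j))

  enumeration-unique : ∀ {f g : ℕ → ℕ} → f Preserves _<_ ⟶ _<_ → g Preserves _<_ ⟶ _<_ →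
                       (∀ i → ∃[ j ] g j ≡ f i) → (∀ i → ∃[ j ] f j ≡ g i) → ∀ i → f i ≡ g i
  enumeration-unique {f} {g} f-mono g-mono f⊆g g⊆f = <-rec (λ i → f i ≡ g i) λ i agree →
    ≤-antisym (enumeration-≤ g-mono f-mono i (λ j<i → sym (agree j<i)) (g⊆f i))
              (enumeration-≤ f-mono g-mono i agree (f⊆g i))

  -- u² − 34uv + v² = 36 (defect⁺ y z − defect⁻ y z) for consecutive terms y, z.
  defect⁺ defect⁻ : ℕ → ℕ → ℕ
  defect⁺ y z = 6 * (y * y * z) + 35 * (y * y) + 4 * y + 2 * z
  defect⁻ y z = 2 * (y * y * y) + 8 * (y * z) + 1

  defect⁻≤defect⁺ : ∀ {y z} → 2 ≤ y → y ≤ z → defect⁻ y z ≤ defect⁺ y z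
  defect⁻≤defect⁺ {y} {z} 2≤y y≤z = begin
    defect⁻ y z                                                          ≡⟨ regroup₁ y z ⟩
    2 * (y * y * y) + 4 * (2 * (y * z)) + 1                              ≤⟨ +-mono-≤ (+-mono-≤ y³≤y²z 2yz≤y²z) 1≤4y ⟩
    2 * (y * y * z) + 4 * (y * (y * z)) + 4 * y                          ≤⟨ m≤m+n _ (35 * (y * y) + 2 * z) ⟩
    2 * (y * y * z) + 4 * (y * (y * z)) + 4 * y + (35 * (y * y) + 2 * z) ≡⟨ regroup₂ y z ⟩
    defect⁺ y z                                                          ∎
    where
    open ≤-Reasoning
    y³≤y²z : 2 * (y * y * y) ≤ 2 * (y * y * z)
    y³≤y²z = *-monoʳ-≤ 2 (*-monoʳ-≤ (y * y) y≤z)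
    2yz≤y²z : 4 * (2 * (y * z)) ≤ 4 * (y * (y * z))
    2yz≤y²z = *-monoʳ-≤ 4 (*-monoˡ-≤ (y * z) 2≤y)
    1≤4y : 1 ≤ 4 * y
    1≤4y = ≤-trans (≤-trans (s≤s z≤n) 2≤y) (m≤n*m y 4)
    regroup₁ : ∀ y z → 2 * (y * y * y) + 8 * (y * z) + 1 ≡ 2 * (y * y * y) + 4 * (2 * (y * z)) + 1
    regroup₁ = solve-∀
    regroup₂ : ∀ y z → 2 * (y * y * z) + 4 * (y * (y * z)) + 4 * y + (35 * (y * y) + 2 * z) ≡ 6 * (y * y * z) + 35 * (y * y) + 4 * y + 2 * z
    regroup₂ = solve-∀

  defect⁺≤47y²z : ∀ {y z} → 1 ≤ y → 1 ≤ z → defect⁺ y z ≤ 47 * (y * y * z)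
  defect⁺≤47y²z {y} {z} 1≤y 1≤z = begin
    6 * (y * y * z) + 35 * (y * y) + 4 * y + 2 * z
      ≤⟨ +-mono-≤ (+-mono-≤ (+-monoʳ-≤ (6 * (y * y * z)) (*-monoʳ-≤ 35 y²≤y²z)) (*-monoʳ-≤ 4 y≤y²z)) (*-monoʳ-≤ 2 z≤y²z) ⟩
    6 * (y * y * z) + 35 * (y * y * z) + 4 * (y * y * z) + 2 * (y * y * z)
      ≡⟨ collect (y * y * z) ⟩
    47 * (y * y * z)
      ∎
    where
    open ≤-Reasoning
    instance
      y-nonZero : NonZero y
      y-nonZero = >-nonZero 1≤y
      z-nonZero : NonZero z
      z-nonZero = >-nonZero 1≤z
    y²≤y²z : y * y ≤ y * y * z
    y²≤y²z = m≤m*n (y * y) z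
    y≤y²z : y ≤ y * y * z
    y≤y²z = ≤-trans (m≤m*n y y) y²≤y²z
    z≤y²z : z ≤ y * y * z
    z≤y²z = m≤n*m z (y * y) {{m*n≢0 y y}}
    collect : ∀ t → 6 * t + 35 * t + 4 * t + 2 * t ≡ 47 * t
    collect = solve-∀

  z≤2z∸1 : ∀ {z} → 1 ≤ z → z ≤ 2 * z ∸ 1
  z≤2z∸1 {z} 1≤z = m+n≤o⇒m≤o∸n z (≤-trans (+-monoʳ-≤ z 1≤z) (≤-reflexive (cong (z +_) (sym (+-identityʳ z)))))

  2z∸1<2z : ∀ {z} → 1 ≤ z → 2 * z ∸ 1 < 2 * z
  2z∸1<2z {z} 1≤z = ∸-monoʳ-< {o = 0} (s≤s z≤n) (≤-trans 1≤z (m≤n*m z 2))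

  17*[2z∸1]x<[2y∸1]z : ∀ {x y z} → 1 ≤ x → 17 * x < y → 1 ≤ z → 17 * ((2 * z ∸ 1) * x) < (2 * y ∸ 1) * z
  17*[2z∸1]x<[2y∸1]z {x} {y} {z} 1≤x 17x<y 1≤z = begin-strict
    17 * ((2 * z ∸ 1) * x) <⟨ *-monoʳ-< 17 (*-monoˡ-< x (2z∸1<2z 1≤z)) ⟩
    17 * (2 * z * x)       ≡⟨ regroup x z ⟩
    34 * x * z             ≤⟨ *-monoˡ-≤ z 34x≤2y∸1 ⟩
    (2 * y ∸ 1) * z        ∎
    where
    open ≤-Reasoning
    instance
      x-nonZero : NonZero x
      x-nonZero = >-nonZero 1≤x
    regroup : ∀ x z → 17 * (2 * z * x) ≡ 34 * x * z
    regroup = solve-∀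
    34x≤2y∸1 : 34 * x ≤ 2 * y ∸ 1
    34x≤2y∸1 = m+n≤o⇒m≤o∸n (34 * x) (begin
      34 * x + 1       ≤⟨ +-monoʳ-≤ (34 * x) (n≤1+n 1) ⟩
      34 * x + 2       ≡⟨ double x ⟩
      2 * suc (17 * x) ≤⟨ *-monoʳ-≤ 2 17x<y ⟩
      2 * y            ∎)
      where
      double : ∀ x → 34 * x + 2 ≡ 2 * suc (17 * x)
      double = solve-∀

  -- 36 · 47 · 36²: the factor of the defect, defect⁺≤47y²z, and y ≤ 36x.
  defectConstant : ℕ
  defectConstant = 36 * 47 * 1296

  defect⁺-small : ∀ {x y z K} → 1 ≤ x → 1 ≤ y → y ≤ 36 * x → 1 ≤ z → defectConstant * K < z →
                 36 * defect⁺ y z * K < (2 * z ∸ 1) * x * ((2 * z ∸ 1) * x)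
  defect⁺-small {x} {y} {z} {K} 1≤x 1≤y y≤36x 1≤z CK<z = begin-strict
    36 * defect⁺ y z * K                    ≤⟨ *-monoˡ-≤ K (*-monoʳ-≤ 36 (defect⁺≤47y²z 1≤y 1≤z)) ⟩
    36 * (47 * (y * y * z)) * K             ≤⟨ *-monoˡ-≤ K (*-monoʳ-≤ 36 (*-monoʳ-≤ 47 (*-monoˡ-≤ z y²≤))) ⟩
    36 * (47 * (36 * x * (36 * x) * z)) * K ≡⟨ regroup x z K ⟩
    defectConstant * K * (x * x * z)        <⟨ *-monoˡ-< (x * x * z) {{m*n≢0 (x * x) z {{m*n≢0 x x}}}} CK<z ⟩
    z * (x * x * z)                         ≡⟨ square z x ⟩
    z * x * (z * x)                         ≤⟨ *-mono-≤ zx≤v zx≤v ⟩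
    (2 * z ∸ 1) * x * ((2 * z ∸ 1) * x)     ∎
    where
    open ≤-Reasoning
    instance
      x-nonZero : NonZero x
      x-nonZero = >-nonZero 1≤x
      z-nonZero : NonZero z
      z-nonZero = >-nonZero 1≤z
    y²≤ : y * y ≤ 36 * x * (36 * x)
    y²≤ = *-mono-≤ y≤36x y≤36x
    zx≤v : z * x ≤ (2 * z ∸ 1) * x
    zx≤v = *-monoˡ-≤ x (z≤2z∸1 1≤z)
    regroup : ∀ x z K → 36 * (47 * (36 * x * (36 * x) * z)) * K ≡ defectConstant * K * (x * x * z)
    regroup = solve-∀
    square : ∀ z x → z * (x * x * z) ≡ z * x * (z * x)
    square = solve-∀

module RationalAlgebra where

  open TriangularSquares using (defect⁺; defect⁻)
  open import Data.Empty using (⊥-elim)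
  open import Data.Integer as ℤ using (+_)
  import Data.Integer.Properties as ℤ
  open import Data.Maybe using (Maybe; just; nothing)
  open import Data.Nat as ℕ using (suc)
  import Data.Nat.Properties as ℕ
  open import Data.Product using (_,_)
  open import Data.Rational as ℚ using (ℚ; 0ℚ; 1ℚ; _+_; _*_; _-_; -_; _<_; _≤_)
  open import Data.Rational.Properties as ℚ using (+-*-commutativeRing)
  open import Data.Rational.Unnormalised as ℚᵘ using (ℚᵘ; mkℚᵘ; *≡*; *<*)
  import Data.Rational.Unnormalised.Properties as ℚᵘ
  open import Data.Sum using (inj₁; inj₂)
  open import Relation.Binary.PropositionalEquality
  open import Relation.Nullary using (yes; no)
  open import Algebra.Properties.Group ℚ.+-0-group using (x≈z//y; ⁻¹-involutive)
  import Tactic.RingSolver.Core.AlmostCommutativeRing as ACR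
  open import Tactic.RingSolver using (solve-∀)

  ℚ-ring : ACR.AlmostCommutativeRing _ _
  ℚ-ring = ACR.fromCommutativeRing +-*-commutativeRing isZero
    where
    isZero : ∀ x → Maybe (0ℚ ≡ x)
    isZero x with 0ℚ ℚ.≟ x
    ... | yes eq = just eq
    ... | no _ = nothing

  fromℕᵘ : ℕ → ℚᵘ
  fromℕᵘ n = mkℚᵘ (+ n) 0

  toℚᵘ-fromℕ : ∀ n → ℚ.toℚᵘ (fromℕ n) ℚᵘ.≃ fromℕᵘ n
  toℚᵘ-fromℕ n = ℚ.toℚᵘ-fromℚᵘ (fromℕᵘ n)

  fromℕ-+ : ∀ m n → fromℕ (m ℕ.+ n) ≡ fromℕ m + fromℕ n
  fromℕ-+ m n = ℚ.toℚᵘ-injective (begin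
    ℚ.toℚᵘ (fromℕ (m ℕ.+ n))               ≈⟨ toℚᵘ-fromℕ (m ℕ.+ n) ⟩
    fromℕᵘ (m ℕ.+ n)                       ≈⟨ *≡* numerators ⟩
    fromℕᵘ m ℚᵘ.+ fromℕᵘ n                 ≈⟨ ℚᵘ.+-cong (toℚᵘ-fromℕ m) (toℚᵘ-fromℕ n) ⟨
    ℚ.toℚᵘ (fromℕ m) ℚᵘ.+ ℚ.toℚᵘ (fromℕ n) ≈⟨ ℚ.toℚᵘ-homo-+ (fromℕ m) (fromℕ n) ⟨
    ℚ.toℚᵘ (fromℕ m + fromℕ n)             ∎)
    where
    open ℚᵘ.≃-Reasoning
    numerators : + (m ℕ.+ n) ℤ.* + 1 ≡ (+ m ℤ.* + 1 ℤ.+ + n ℤ.* + 1) ℤ.* + 1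
    numerators = trans (ℤ.*-identityʳ _) (trans (ℤ.pos-+ m n)
      (sym (trans (ℤ.*-identityʳ _) (cong₂ ℤ._+_ (ℤ.*-identityʳ (+ m)) (ℤ.*-identityʳ (+ n))))))

  fromℕ-* : ∀ m n → fromℕ (m ℕ.* n) ≡ fromℕ m * fromℕ n
  fromℕ-* m n = ℚ.toℚᵘ-injective (begin
    ℚ.toℚᵘ (fromℕ (m ℕ.* n))               ≈⟨ toℚᵘ-fromℕ (m ℕ.* n) ⟩
    fromℕᵘ (m ℕ.* n)                       ≈⟨ *≡* (cong (ℤ._* + 1) (ℤ.pos-* m n)) ⟩
    fromℕᵘ m ℚᵘ.* fromℕᵘ n                 ≈⟨ ℚᵘ.*-cong (toℚᵘ-fromℕ m) (toℚᵘ-fromℕ n) ⟨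
    ℚ.toℚᵘ (fromℕ m) ℚᵘ.* ℚ.toℚᵘ (fromℕ n) ≈⟨ ℚ.toℚᵘ-homo-* (fromℕ m) (fromℕ n) ⟨
    ℚ.toℚᵘ (fromℕ m * fromℕ n)             ∎)
    where open ℚᵘ.≃-Reasoning

  fromℕ-mono-< : ∀ {m n} → m ℕ.< n → fromℕ m < fromℕ n
  fromℕ-mono-< {m} {n} m<n = ℚ.toℚᵘ-cancel-< (begin-strict
    ℚ.toℚᵘ (fromℕ m) ≃⟨ toℚᵘ-fromℕ m ⟩
    fromℕᵘ m         <⟨ *<* (ℤ.*-monoʳ-<-pos (+ 1) (ℤ.+<+ m<n)) ⟩
    fromℕᵘ n         ≃⟨ toℚᵘ-fromℕ n ⟨
    ℚ.toℚᵘ (fromℕ n) ∎)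
    where open ℚᵘ.≤-Reasoning

  fromℕ-mono-≤ : ∀ {m n} → m ℕ.≤ n → fromℕ m ≤ fromℕ n
  fromℕ-mono-≤ m≤n with ℕ.m≤n⇒m<n∨m≡n m≤n
  ... | inj₁ m<n = ℚ.<⇒≤ (fromℕ-mono-< m<n)
  ... | inj₂ refl = ℚ.≤-refl

  fromℕ-nonNeg : ∀ n → 0ℚ ≤ fromℕ n
  fromℕ-nonNeg n = fromℕ-mono-≤ {0} {n} ℕ.z≤n

  fromℕ-∸ : ∀ {m n} → n ℕ.≤ m → fromℕ (m ℕ.∸ n) ≡ fromℕ m - fromℕ n
  fromℕ-∸ {m} {n} n≤m = begin
    fromℕ (m ℕ.∸ n)                     ≡⟨ add-sub (fromℕ (m ℕ.∸ n)) (fromℕ n) ⟨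
    fromℕ (m ℕ.∸ n) + fromℕ n - fromℕ n ≡⟨ cong (_- fromℕ n) (fromℕ-+ (m ℕ.∸ n) n) ⟨
    fromℕ (m ℕ.∸ n ℕ.+ n) - fromℕ n     ≡⟨ cong (λ k → fromℕ k - fromℕ n) (ℕ.m∸n+n≡m n≤m) ⟩
    fromℕ m - fromℕ n                   ∎
    where
    open ≡-Reasoning
    add-sub : ∀ a b → a + b - b ≡ a
    add-sub = solve-∀ ℚ-ring

  fromℕ-2*∸1 : ∀ {n} → 1 ℕ.≤ n → fromℕ (2 ℕ.* n ℕ.∸ 1) ≡ fromℕ 2 * fromℕ n - 1ℚ
  fromℕ-2*∸1 {n} 1≤n = trans (fromℕ-∸ (ℕ.≤-trans 1≤n (ℕ.m≤n*m n 2))) (cong (_- 1ℚ) (fromℕ-* 2 n))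

  fromℕ-*³ : ∀ a b c → fromℕ (a ℕ.* b ℕ.* c) ≡ fromℕ a * fromℕ b * fromℕ c
  fromℕ-*³ a b c = trans (fromℕ-* (a ℕ.* b) c) (cong (_* fromℕ c) (fromℕ-* a b))

  fromℕ-+³ : ∀ a b c → fromℕ (a ℕ.+ b ℕ.+ c) ≡ fromℕ a + fromℕ b + fromℕ c
  fromℕ-+³ a b c = trans (fromℕ-+ (a ℕ.+ b) c) (cong (_+ fromℕ c) (fromℕ-+ a b))

  fromℕ-defect⁺ : ∀ y z → let Y = fromℕ y ; Z = fromℕ z in
    fromℕ (defect⁺ y z) ≡ fromℕ 6 * (Y * Y * Z) + fromℕ 35 * (Y * Y) + fromℕ 4 * Y + fromℕ 2 * Z
  fromℕ-defect⁺ y z = begin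
    fromℕ (6 ℕ.* (y ℕ.* y ℕ.* z) ℕ.+ 35 ℕ.* (y ℕ.* y) ℕ.+ 4 ℕ.* y ℕ.+ 2 ℕ.* z)
      ≡⟨ trans (fromℕ-+ (6 ℕ.* (y ℕ.* y ℕ.* z) ℕ.+ 35 ℕ.* (y ℕ.* y) ℕ.+ 4 ℕ.* y) (2 ℕ.* z))
               (cong (_+ fromℕ (2 ℕ.* z)) (fromℕ-+³ (6 ℕ.* (y ℕ.* y ℕ.* z)) (35 ℕ.* (y ℕ.* y)) (4 ℕ.* y))) ⟩
    fromℕ (6 ℕ.* (y ℕ.* y ℕ.* z)) + fromℕ (35 ℕ.* (y ℕ.* y)) + fromℕ (4 ℕ.* y) + fromℕ (2 ℕ.* z)
      ≡⟨ cong₂ _+_ (cong₂ _+_ (cong₂ _+_ (trans (fromℕ-* 6 (y ℕ.* y ℕ.* z)) (cong (fromℕ 6 *_) (fromℕ-*³ y y z)))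
                                          (trans (fromℕ-* 35 (y ℕ.* y)) (cong (fromℕ 35 *_) (fromℕ-* y y))))
                               (fromℕ-* 4 y))
                   (fromℕ-* 2 z) ⟩
    fromℕ 6 * (Y * Y * Z) + fromℕ 35 * (Y * Y) + fromℕ 4 * Y + fromℕ 2 * Z
      ∎
    where
    open ≡-Reasoning
    Y = fromℕ y ; Z = fromℕ z

  fromℕ-defect⁻ : ∀ y z → let Y = fromℕ y ; Z = fromℕ z in
    fromℕ (defect⁻ y z) ≡ fromℕ 2 * (Y * Y * Y) + fromℕ 8 * (Y * Z) + 1ℚ
  fromℕ-defect⁻ y z =
    trans (fromℕ-+³ (2 ℕ.* (y ℕ.* y ℕ.* y)) (8 ℕ.* (y ℕ.* z)) 1) (cong₂ (λ s t → s + t + 1ℚ) (trans (fromℕ-* 2 (y ℕ.* y ℕ.* y)) (cong (fromℕ 2 *_) (fromℕ-*³ y y y)))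
                                                     (trans (fromℕ-* 8 (y ℕ.* z)) (cong (fromℕ 8 *_) (fromℕ-* y z))))

  ratio-* : ∀ p q → 1 ℕ.≤ q → ratio p q * fromℕ q ≡ fromℕ p
  ratio-* p (suc q) _ = ℚ.toℚᵘ-injective (begin
    ℚ.toℚᵘ (ratio p (suc q) * fromℕ (suc q))             ≈⟨ ℚ.toℚᵘ-homo-* (ratio p (suc q)) (fromℕ (suc q)) ⟩
    ℚ.toℚᵘ (ratio p (suc q)) ℚᵘ.* ℚ.toℚᵘ (fromℕ (suc q)) ≈⟨ ℚᵘ.*-cong (ℚ.toℚᵘ-fromℚᵘ (mkℚᵘ (+ p) q)) (toℚᵘ-fromℕ (suc q)) ⟩
    mkℚᵘ (+ p) q ℚᵘ.* fromℕᵘ (suc q)                     ≈⟨ *≡* (trans (ℤ.*-identityʳ _) (cong (λ d → + p ℤ.* + d) (sym (ℕ.*-identityʳ (suc q))))) ⟩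
    fromℕᵘ p                                             ≈⟨ toℚᵘ-fromℕ p ⟨
    ℚ.toℚᵘ (fromℕ p)                                     ∎)
    where open ℚᵘ.≃-Reasoning

  *-pos : ∀ {a b} → 0ℚ < a → 0ℚ < b → 0ℚ < a * b
  *-pos {a} {b} 0<a 0<b = ℚ.positive⁻¹ _ {{ℚ.pos*pos⇒pos a {{ℚ.positive 0<a}} b {{ℚ.positive 0<b}}}}

  *-nonNeg : ∀ {a b} → 0ℚ ≤ a → 0ℚ ≤ b → 0ℚ ≤ a * b
  *-nonNeg {a} {b} 0≤a 0≤b =
    ℚ.nonNegative⁻¹ _ {{ℚ.nonNeg*nonNeg⇒nonNeg a {{ℚ.nonNegative 0≤a}} b {{ℚ.nonNegative 0≤b}}}}

  +-pos : ∀ {a b} → 0ℚ < a → 0ℚ ≤ b → 0ℚ < a + b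
  +-pos {a} {b} 0<a 0≤b = ℚ.positive⁻¹ _ {{ℚ.pos+nonNeg⇒pos a {{ℚ.positive 0<a}} b {{ℚ.nonNegative 0≤b}}}}

  <-by-pos-gap : ∀ {a b d} → 0ℚ < d → a + d ≡ b → a < b
  <-by-pos-gap {a} {b} {d} 0<d eq = subst₂ _<_ (ℚ.+-identityʳ a) eq (ℚ.+-monoʳ-< a 0<d)

  sub-pos : ∀ {a b} → a < b → 0ℚ < b - a
  sub-pos {a} {b} a<b = subst₂ _<_ (ℚ.+-inverseʳ a) refl (ℚ.+-monoˡ-< (- a) a<b)

  equal-modulo : ∀ {a b c d} k → a - b ≡ k * (c - d) → c ≡ d → a ≡ b
  equal-modulo {a} {b} {c} k eq refl = begin
    a               ≡⟨ sub-add a b ⟨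
    a - b + b       ≡⟨ cong (_+ b) eq ⟩
    k * (c - c) + b ≡⟨ cancel k c b ⟩
    b               ∎
    where
    open ≡-Reasoning
    sub-add : ∀ a b → a - b + b ≡ a
    sub-add = solve-∀ ℚ-ring
    cancel : ∀ k c b → k * (c - c) + b ≡ b
    cancel = solve-∀ ℚ-ring

  qdiv-* : ∀ x {y} → y ≢ 0ℚ → qdiv x y * y ≡ x
  qdiv-* x {y} y≢0 with y ℚ.≟ 0ℚ
  ... | yes y≡0 = ⊥-elim (y≢0 y≡0)
  ... | no y≢0′ = begin
    x * ℚ.1/ y * y   ≡⟨ ℚ.*-assoc x (ℚ.1/ y) y ⟩
    x * (ℚ.1/ y * y) ≡⟨ cong (x *_) (ℚ.*-inverseˡ y) ⟩
    x * 1ℚ           ≡⟨ ℚ.*-identityʳ x ⟩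
    x                ∎
    where
    open ≡-Reasoning
    instance
      y-nonZero : ℚ.NonZero y
      y-nonZero = ℚ.≢-nonZero y≢0′

  ratio-difference : ∀ {a b c e} → 1 ℕ.≤ a → 1 ℕ.≤ b → fromℕ a * fromℕ c + e ≡ fromℕ b * fromℕ b →
    (ratio c b - ratio b a) * (fromℕ a * fromℕ b) ≡ - e
  ratio-difference {a} {b} {c} {e} 1≤a 1≤b ac+e≡b² = begin
    (ratio c b - ratio b a) * (A * B)     ≡⟨ distribute (ratio c b) (ratio b a) A B ⟩
    ratio c b * B * A - ratio b a * A * B ≡⟨ cong₂ (λ s t → s * A - t * B) (ratio-* c b 1≤b) (ratio-* b a 1≤a) ⟩
    C * A - B * B                         ≡⟨ equal-modulo 1ℚ (identity A B C e) ac+e≡b² ⟩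
    - e                                   ∎
    where
    open ≡-Reasoning
    A = fromℕ a ; B = fromℕ b ; C = fromℕ c
    distribute : ∀ p q a b → (p - q) * (a * b) ≡ p * b * a - q * a * b
    distribute = solve-∀ ℚ-ring
    identity : ∀ a b c e → c * a - b * b - - e ≡ 1ℚ * (a * c + e - b * b)
    identity = solve-∀ ℚ-ring

  second-difference-ratio : ∀ x y z w {e f} → 1 ℕ.≤ x → 1 ℕ.≤ y → 1 ℕ.≤ z → f ≢ 0ℚ →
    fromℕ x * fromℕ z + e ≡ fromℕ y * fromℕ y → fromℕ y * fromℕ w + f ≡ fromℕ z * fromℕ z →
    qdiv (ratio z y - ratio y x) (ratio w z - ratio z y) * (f * fromℕ x) ≡ e * fromℕ z
  second-difference-ratio x y z w {e} {f} 1≤x 1≤y 1≤z f≢0 xz+e≡y² yw+f≡z² = begin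
    r * (f * X)                ≡⟨ cong (λ t → r * (t * X)) (trans (sym (⁻¹-involutive f)) (cong -_ (sym d₂))) ⟩
    r * (- (B₂ * (Y * Z)) * X) ≡⟨ reorder r B₂ X Y Z ⟩
    - (r * B₂ * (X * Y) * Z)   ≡⟨ cong (λ t → - (t * (X * Y) * Z)) (qdiv-* B₁ B₂≢0) ⟩
    - (B₁ * (X * Y) * Z)       ≡⟨ cong (λ t → - (t * Z)) d₁ ⟩
    - (- e * Z)                ≡⟨ neg-neg e Z ⟩
    e * Z                      ∎
    where
    open ≡-Reasoning
    X = fromℕ x ; Y = fromℕ y ; Z = fromℕ z
    B₁ = ratio z y - ratio y x
    B₂ = ratio w z - ratio z y
    r = qdiv B₁ B₂
    d₁ : B₁ * (X * Y) ≡ - e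
    d₁ = ratio-difference {x} {y} {z} {e} 1≤x 1≤y xz+e≡y²
    d₂ : B₂ * (Y * Z) ≡ - f
    d₂ = ratio-difference {y} {z} {w} {f} 1≤y 1≤z yw+f≡z²
    B₂≢0 : B₂ ≢ 0ℚ
    B₂≢0 B₂≡0 = f≢0 (ℚ.neg-injective (trans (sym d₂) (trans (cong (_* (Y * Z)) B₂≡0) (ℚ.*-zeroˡ (Y * Z)))))
    reorder : ∀ r b x y z → r * (- (b * (y * z)) * x) ≡ - (r * b * (x * y) * z)
    reorder = solve-∀ ℚ-ring
    neg-neg : ∀ e z → - (- e * z) ≡ e * z
    neg-neg = solve-∀ ℚ-ring

  Recurrent : ℚ → ℚ → ℚ → Set
  Recurrent x y z = x + z ≡ fromℕ 34 * y + fromℕ 2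

  Adjacent : ℚ → ℚ → Set
  Adjacent x y = x * x + y * y + 1ℚ ≡ fromℕ 34 * (x * y) + fromℕ 2 * (x + y)

  recurrent-next : ∀ {x y z} → Recurrent x y z → z ≡ fromℕ 34 * y + fromℕ 2 - x
  recurrent-next {x} {y} {z} rec = x≈z//y z x (fromℕ 34 * y + fromℕ 2) (trans (ℚ.+-comm z x) rec)

  recurrent-prev : ∀ {x y z} → Recurrent x y z → x ≡ fromℕ 34 * y + fromℕ 2 - z
  recurrent-prev {x} {y} {z} rec = x≈z//y x z (fromℕ 34 * y + fromℕ 2) rec

  adjacent-next : ∀ x y z → Adjacent x y → Recurrent x y z → Adjacent y z
  adjacent-next x y z adj rec =
    subst (Adjacent y) (sym (recurrent-next {x} {y} {z} rec)) (equal-modulo 1ℚ (identity x y) adj)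
    where
    identity : ∀ x y → let z = fromℕ 34 * y + fromℕ 2 - x in
      y * y + z * z + 1ℚ - (fromℕ 34 * (y * z) + fromℕ 2 * (y + z))
        ≡ 1ℚ * (x * x + y * y + 1ℚ - (fromℕ 34 * (x * y) + fromℕ 2 * (x + y)))
    identity = solve-∀ ℚ-ring

  adjacent-product : ∀ x y z → Adjacent x y → Recurrent x y z → x * z + (fromℕ 2 * y - 1ℚ) ≡ y * y
  adjacent-product x y z adj rec =
    subst (λ z → x * z + (fromℕ 2 * y - 1ℚ) ≡ y * y) (sym (recurrent-next {x} {y} {z} rec))
          (equal-modulo (- 1ℚ) (identity x y) adj)
    where
    identity : ∀ x y → x * (fromℕ 34 * y + fromℕ 2 - x) + (fromℕ 2 * y - 1ℚ) - y * y
        ≡ - 1ℚ * (x * x + y * y + 1ℚ - (fromℕ 34 * (x * y) + fromℕ 2 * (x + y)))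
    identity = solve-∀ ℚ-ring

  -- The multiplier is the quotient of the left side by the Adjacent relation, as polynomials in z.
  adjacent-defect : ∀ x y z → Adjacent y z → Recurrent x y z →
    let u = (fromℕ 2 * y - 1ℚ) * z ; v = (fromℕ 2 * z - 1ℚ) * x in
    u * u - fromℕ 34 * (u * v) + v * v
      ≡ fromℕ 36 * ((fromℕ 6 * (y * y * z) + fromℕ 35 * (y * y) + fromℕ 4 * y + fromℕ 2 * z)
                   - (fromℕ 2 * (y * y * y) + fromℕ 8 * (y * z) + 1ℚ))
  adjacent-defect x y z adj rec =
    subst (λ x → let u = (fromℕ 2 * y - 1ℚ) * z ; v = (fromℕ 2 * z - 1ℚ) * x in
                 u * u - fromℕ 34 * (u * v) + v * v ≡ _)
          (sym (recurrent-prev {x} {y} {z} rec))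
          (equal-modulo (fromℕ 40 - fromℕ 80 * z + fromℕ 4 * (z * z) + fromℕ 72 * y) (identity y z) adj)
    where
    identity : ∀ y z → let x = fromℕ 34 * y + fromℕ 2 - z
                           u = (fromℕ 2 * y - 1ℚ) * z ; v = (fromℕ 2 * z - 1ℚ) * x in
      u * u - fromℕ 34 * (u * v) + v * v
        - fromℕ 36 * ((fromℕ 6 * (y * y * z) + fromℕ 35 * (y * y) + fromℕ 4 * y + fromℕ 2 * z)
                     - (fromℕ 2 * (y * y * y) + fromℕ 8 * (y * z) + 1ℚ))
        ≡ (fromℕ 40 - fromℕ 80 * z + fromℕ 4 * (z * z) + fromℕ 72 * y)
          * (y * y + z * z + 1ℚ - (fromℕ 34 * (y * z) + fromℕ 2 * (y + z)))
    identity = solve-∀ ℚ-ring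

  -- 17 + 12√2 is the larger root.
  charPoly : ℚ → ℚ
  charPoly r = r * r - fromℕ 34 * r + 1ℚ

  -- With t = r − 17 one has t² = 288 + charPoly r, and 288 = (12√2)².
  within-of-root : ∀ {e r} → 0ℚ < e → fromℕ 17 < r → 0ℚ ≤ charPoly r → charPoly r < e * e → WithinOfL e r
  within-of-root {e} {r} 0<e 17<r 0≤c c<e² = below , above
    where
    0<2 : 0ℚ < fromℕ 2
    0<2 = fromℕ-mono-< {0} {2} (ℕ.s≤s ℕ.z≤n)
    t = r - fromℕ 17
    0<t : 0ℚ < t
    0<t = sub-pos 17<r
    s = r - e - fromℕ 17
    below-square : 0ℚ ≤ s → s * s < fromℕ 288
    below-square 0≤s = <-by-pos-gap (+-pos (sub-pos c<e²) (*-nonNeg (ℚ.<⇒≤ (*-pos 0<2 0<e)) 0≤s))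
                                    (identity r e)
      where
      identity : ∀ r e → let s = r - e - fromℕ 17 in
        s * s + (e * e - (r * r - fromℕ 34 * r + 1ℚ) + fromℕ 2 * e * s) ≡ fromℕ 288
      identity = solve-∀ ℚ-ring
    below : BelowL (r - e)
    below with s ℚ.<? 0ℚ
    ... | yes s<0 = inj₁ s<0
    ... | no s≮0 = inj₂ (below-square (ℚ.≮⇒≥ s≮0))
    above : AboveL (r + e)
    above = subst (0ℚ <_) (shift r e) (ℚ.+-mono-< 0<t 0<e)
          , <-by-pos-gap (+-pos (*-pos 0<e (+-pos 0<e (ℚ.<⇒≤ (*-pos 0<2 0<t)))) 0≤c) (identity r e)
      where
      shift : ∀ r e → r - fromℕ 17 + e ≡ r + e - fromℕ 17
      shift = solve-∀ ℚ-ring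
      identity : ∀ r e → let s = r + e - fromℕ 17 in
        fromℕ 288 + (e * (e + fromℕ 2 * (r - fromℕ 17)) + (r * r - fromℕ 34 * r + 1ℚ)) ≡ s * s
      identity = solve-∀ ℚ-ring

  within-of-scaled-root : ∀ {e r u v d K} → 0ℚ < e → 1ℚ ≤ e * e * fromℕ K → r * fromℕ v ≡ fromℕ u →
    fromℕ u * fromℕ u - fromℕ 34 * (fromℕ u * fromℕ v) + fromℕ v * fromℕ v ≡ fromℕ d →
    17 ℕ.* v ℕ.< u → d ℕ.* K ℕ.< v ℕ.* v → WithinOfL e r
  within-of-scaled-root {e} {r} {u} {v} {d} {K} 0<e 1≤e²K rv≡u defect 17v<u dK<v² =
    within-of-root 0<e 17<r 0≤c c<e²
    where
    U = fromℕ u ; V = fromℕ v ; D = fromℕ d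
    0<V² : 0ℚ < V * V
    0<V² = subst (0ℚ <_) (fromℕ-* v v) (fromℕ-mono-< (ℕ.≤-<-trans ℕ.z≤n dK<v²))
    instance
      V²-positive : ℚ.Positive (V * V)
      V²-positive = ℚ.positive 0<V²
      V²-nonNegative : ℚ.NonNegative (V * V)
      V²-nonNegative = ℚ.pos⇒nonNeg (V * V)
    scaled : charPoly r * (V * V) ≡ D
    scaled = begin
      charPoly r * (V * V)                             ≡⟨ expand r V ⟩
      r * V * (r * V) - fromℕ 34 * (r * V * V) + V * V ≡⟨ cong (λ t → t * t - fromℕ 34 * (t * V) + V * V) rv≡u ⟩
      U * U - fromℕ 34 * (U * V) + V * V               ≡⟨ defect ⟩
      D                                                ∎
      where
      open ≡-Reasoning
      expand : ∀ r V → (r * r - fromℕ 34 * r + 1ℚ) * (V * V) ≡ r * V * (r * V) - fromℕ 34 * (r * V * V) + V * V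
      expand = solve-∀ ℚ-ring
    17<r : fromℕ 17 < r
    17<r = ℚ.*-cancelʳ-<-nonNeg V {{ℚ.nonNegative (fromℕ-nonNeg v)}}
             (subst₂ _<_ (fromℕ-* 17 v) (sym rv≡u) (fromℕ-mono-< 17v<u))
    0≤c : 0ℚ ≤ charPoly r
    0≤c = ℚ.*-cancelʳ-≤-pos (V * V) (subst₂ _≤_ (sym (ℚ.*-zeroˡ (V * V))) (sym scaled) (fromℕ-nonNeg d))
    c<e² : charPoly r < e * e
    c<e² = ℚ.*-cancelʳ-<-nonNeg (V * V) (begin-strict
      charPoly r * (V * V)    ≡⟨ scaled ⟩
      D                       ≡⟨ ℚ.*-identityˡ D ⟨
      1ℚ * D                  ≤⟨ ℚ.*-monoʳ-≤-nonNeg D {{ℚ.nonNegative (fromℕ-nonNeg d)}} 1≤e²K ⟩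
      e * e * fromℕ K * D     ≡⟨ regroup (e * e) (fromℕ K) D ⟩
      e * e * (D * fromℕ K)   ≡⟨ cong (e * e *_) (fromℕ-* d K) ⟨
      e * e * fromℕ (d ℕ.* K) <⟨ ℚ.*-monoʳ-<-pos (e * e) {{ℚ.positive (*-pos 0<e 0<e)}} (fromℕ-mono-< dK<v²) ⟩
      e * e * fromℕ (v ℕ.* v) ≡⟨ cong (e * e *_) (fromℕ-* v v) ⟩
      e * e * (V * V)         ∎)
      where
      open ℚ.≤-Reasoning
      regroup : ∀ a k d → a * k * d ≡ a * (d * k)
      regroup = solve-∀ ℚ-ring

open TriangularSquares
open RationalAlgebra
import Data.Nat as ℕ
open import Data.Nat using (zero; suc; z≤n; s≤s)
import Data.Nat.Properties as ℕ
open import Data.Integer using (+_; -[1+_])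
open import Data.Rational as ℚ using (mkℚ; 0ℚ; 1ℚ; _+_; _*_; _-_; _<_; _≤_)
import Data.Rational.Properties as ℚ
open import Data.Product using (_,_; _×_; ∃-syntax)
open import Relation.Binary using (_Preserves_⟶_)
open import Relation.Binary.PropositionalEquality

fromℕ-recurrent : ∀ {x y z} → x ℕ.+ z ≡ 34 ℕ.* y ℕ.+ 2 → Recurrent (fromℕ x) (fromℕ y) (fromℕ z)
fromℕ-recurrent {x} {y} {z} eq = begin
  fromℕ x + fromℕ z            ≡⟨ fromℕ-+ x z ⟨
  fromℕ (x ℕ.+ z)              ≡⟨ cong fromℕ eq ⟩
  fromℕ (34 ℕ.* y ℕ.+ 2)       ≡⟨ fromℕ-+ (34 ℕ.* y) 2 ⟩
  fromℕ (34 ℕ.* y) + fromℕ 2   ≡⟨ cong (_+ fromℕ 2) (fromℕ-* 34 y) ⟩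
  fromℕ 34 * fromℕ y + fromℕ 2 ∎
  where open ≡-Reasoning

triSq-recurrent : ∀ k → Recurrent (fromℕ (triSq k)) (fromℕ (triSq (1 ℕ.+ k))) (fromℕ (triSq (2 ℕ.+ k)))
triSq-recurrent k = fromℕ-recurrent {triSq k} {triSq (1 ℕ.+ k)} {triSq (2 ℕ.+ k)} (triSq-recurrence k)

triSq-adjacent : ∀ k → Adjacent (fromℕ (triSq k)) (fromℕ (triSq (suc k)))
triSq-adjacent zero = subst₂ Adjacent (cong fromℕ (sym triSq-zero)) (cong fromℕ (sym triSq-one)) refl
triSq-adjacent (suc k) = adjacent-next (fromℕ (triSq k)) (fromℕ (triSq (1 ℕ.+ k))) (fromℕ (triSq (2 ℕ.+ k)))
                                       (triSq-adjacent k) (triSq-recurrent k)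

-- u = (2aⱼ₋₁ − 1)aⱼ, v = (2aⱼ − 1)aⱼ₋₂ and u² − 34uv + v², at j = k + 3.
numer denom defect : ℕ → ℕ
numer k = (2 ℕ.* triSq (2 ℕ.+ k) ℕ.∸ 1) ℕ.* triSq (3 ℕ.+ k)
denom k = (2 ℕ.* triSq (3 ℕ.+ k) ℕ.∸ 1) ℕ.* triSq (1 ℕ.+ k)
defect k = 36 ℕ.* (defect⁺ (triSq (2 ℕ.+ k)) (triSq (3 ℕ.+ k)) ℕ.∸ defect⁻ (triSq (2 ℕ.+ k)) (triSq (3 ℕ.+ k)))

fromℕ-numer : ∀ k → fromℕ (numer k) ≡ (fromℕ 2 * fromℕ (triSq (2 ℕ.+ k)) - 1ℚ) * fromℕ (triSq (3 ℕ.+ k))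
fromℕ-numer k = trans (fromℕ-* (2 ℕ.* triSq (2 ℕ.+ k) ℕ.∸ 1) (triSq (3 ℕ.+ k)))
                      (cong (_* fromℕ (triSq (3 ℕ.+ k))) (fromℕ-2*∸1 (triSq-positive (1 ℕ.+ k))))

fromℕ-denom : ∀ k → fromℕ (denom k) ≡ (fromℕ 2 * fromℕ (triSq (3 ℕ.+ k)) - 1ℚ) * fromℕ (triSq (1 ℕ.+ k))
fromℕ-denom k = trans (fromℕ-* (2 ℕ.* triSq (3 ℕ.+ k) ℕ.∸ 1) (triSq (1 ℕ.+ k)))
                      (cong (_* fromℕ (triSq (1 ℕ.+ k))) (fromℕ-2*∸1 (triSq-positive (2 ℕ.+ k))))

triSq-b-ratio : ∀ k → qdiv (b triSq (2 ℕ.+ k)) (b triSq (3 ℕ.+ k)) * fromℕ (denom k) ≡ fromℕ (numer k)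
triSq-b-ratio k = begin
  r * fromℕ (denom k)
    ≡⟨ cong (r *_) (fromℕ-denom k) ⟩
  r * ((fromℕ 2 * Z - 1ℚ) * X)
    ≡⟨ second-difference-ratio x y z w (triSq-positive k) (triSq-positive (1 ℕ.+ k)) 1≤z 2Z-1≢0
         (adjacent-product X Y Z (triSq-adjacent (1 ℕ.+ k)) (triSq-recurrent (1 ℕ.+ k)))
         (adjacent-product Y Z W (triSq-adjacent (2 ℕ.+ k)) (triSq-recurrent (2 ℕ.+ k))) ⟩
  (fromℕ 2 * Y - 1ℚ) * Z
    ≡⟨ fromℕ-numer k ⟨
  fromℕ (numer k)
    ∎
  where
  open ≡-Reasoning
  r = qdiv (b triSq (2 ℕ.+ k)) (b triSq (3 ℕ.+ k))
  x = triSq (1 ℕ.+ k) ; y = triSq (2 ℕ.+ k) ; z = triSq (3 ℕ.+ k) ; w = triSq (4 ℕ.+ k)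
  X = fromℕ x ; Y = fromℕ y ; Z = fromℕ z ; W = fromℕ w
  1≤z : 1 ℕ.≤ z
  1≤z = triSq-positive (2 ℕ.+ k)
  2Z-1≢0 : fromℕ 2 * Z - 1ℚ ≢ 0ℚ
  2Z-1≢0 eq = ℚ.<-irrefl (sym eq) (subst (0ℚ <_) (fromℕ-2*∸1 1≤z)
                                     (fromℕ-mono-< {0} {2 ℕ.* z ℕ.∸ 1} (ℕ.≤-trans 1≤z (z≤2z∸1 1≤z))))

triSq-defect : ∀ k → let u = fromℕ (numer k) ; v = fromℕ (denom k) in
               u * u - fromℕ 34 * (u * v) + v * v ≡ fromℕ (defect k)
triSq-defect k = begin
  u * u - fromℕ 34 * (u * v) + v * v
    ≡⟨ cong₂ (λ s t → s * s - fromℕ 34 * (s * t) + t * t) (fromℕ-numer k) (fromℕ-denom k) ⟩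
  u′ * u′ - fromℕ 34 * (u′ * v′) + v′ * v′
    ≡⟨ adjacent-defect X Y Z (triSq-adjacent (2 ℕ.+ k)) (triSq-recurrent (1 ℕ.+ k)) ⟩
  fromℕ 36 * (P⁺ - P⁻)
    ≡⟨ cong (fromℕ 36 *_) (cong₂ _-_ (fromℕ-defect⁺ y z) (fromℕ-defect⁻ y z)) ⟨
  fromℕ 36 * (fromℕ (defect⁺ y z) - fromℕ (defect⁻ y z))
    ≡⟨ cong (fromℕ 36 *_) (fromℕ-∸ (defect⁻≤defect⁺ 2≤y (ℕ.<⇒≤ (triSq-< (2 ℕ.+ k))))) ⟨
  fromℕ 36 * fromℕ (defect⁺ y z ℕ.∸ defect⁻ y z)
    ≡⟨ fromℕ-* 36 (defect⁺ y z ℕ.∸ defect⁻ y z) ⟨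
  fromℕ (defect k)
    ∎
  where
  open ≡-Reasoning
  x = triSq (1 ℕ.+ k) ; y = triSq (2 ℕ.+ k) ; z = triSq (3 ℕ.+ k)
  X = fromℕ x ; Y = fromℕ y ; Z = fromℕ z
  u = fromℕ (numer k) ; v = fromℕ (denom k)
  u′ = (fromℕ 2 * Y - 1ℚ) * Z ; v′ = (fromℕ 2 * Z - 1ℚ) * X
  P⁺ = fromℕ 6 * (Y * Y * Z) + fromℕ 35 * (Y * Y) + fromℕ 4 * Y + fromℕ 2 * Z
  P⁻ = fromℕ 2 * (Y * Y * Y) + fromℕ 8 * (Y * Z) + 1ℚ
  2≤y : 2 ℕ.≤ y
  2≤y = ℕ.≤-<-trans (triSq-positive k) (triSq-< (1 ℕ.+ k))

numer-dominates : ∀ k → 17 ℕ.* denom k ℕ.< numer k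
numer-dominates k = 17*[2z∸1]x<[2y∸1]z (triSq-positive k) (triSq-grows (1 ℕ.+ k)) (triSq-positive (2 ℕ.+ k))

defect-small : ∀ {K} k → defectConstant ℕ.* K ℕ.≤ k → defect k ℕ.* K ℕ.< denom k ℕ.* denom k
defect-small {K} k CK≤k =
  ℕ.≤-<-trans (ℕ.*-monoˡ-≤ K (ℕ.*-monoʳ-≤ 36 (ℕ.m∸n≤m (defect⁺ y z) (defect⁻ y z))))
              (defect⁺-small (triSq-positive k) (triSq-positive (1 ℕ.+ k)) (triSq-≤-36* k) (triSq-positive (2 ℕ.+ k))
                             (ℕ.≤-<-trans CK≤k (ℕ.<-≤-trans (ℕ.m<n+m k (s≤s z≤n)) (k≤triSq (3 ℕ.+ k)))))
  where
  y = triSq (2 ℕ.+ k) ; z = triSq (3 ℕ.+ k)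

archimedean : ∀ {d} → 0ℚ < d → ∃[ K ] 1ℚ ≤ d * fromℕ K
archimedean {d@(mkℚ (+ suc p) q _)} _ = suc q ,
  subst (1ℚ ≤_) (sym (trans (cong (_* fromℕ (suc q)) (sym (ℚ.↥p/↧p≡p d))) (ratio-* (suc p) (suc q) (s≤s z≤n))))
        (fromℕ-mono-≤ {1} {suc p} (s≤s z≤n))
archimedean {mkℚ (+ zero) _ _} 0<d with ℚ.positive 0<d
... | ()
archimedean {mkℚ -[1+ _ ] _ _} 0<d with ℚ.positive 0<d
... | ()

enumeration-triSq : ∀ {a} → IsTriSqEnum a → ∀ i → a (suc i) ≡ triSq (suc i)
enumeration-triSq {a} (a-mono , a-TriSq , a-onto) =
  enumeration-unique a-suc-mono (λ i<j → triSq-mono-< (s≤s i<j)) a⊆triSq triSq⊆a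
  where
  a-suc-mono : (λ i → a (suc i)) Preserves ℕ._<_ ⟶ ℕ._<_
  a-suc-mono {i} {j} i<j = a-mono (suc i) (suc j) (s≤s z≤n) (s≤s i<j)
  a⊆triSq : ∀ i → ∃[ j ] triSq (suc j) ≡ a (suc i)
  a⊆triSq i = TriSq⇒triSq (a-TriSq (suc i) (s≤s z≤n))
  positive-index : ∀ {x} → ∃[ j ] (1 ℕ.≤ j × a j ≡ x) → ∃[ j ] a (suc j) ≡ x
  positive-index (suc j , _ , eq) = j , eq
  triSq⊆a : ∀ i → ∃[ j ] a (suc j) ≡ triSq (suc i)
  triSq⊆a i = positive-index (a-onto (triSq (suc i)) (triSq-TriSq i))

b-cong : ∀ {f g : ℕ → ℕ} → (∀ i → f (suc i) ≡ g (suc i)) → ∀ k → b f (2 ℕ.+ k) ≡ b g (2 ℕ.+ k)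
b-cong eq k = cong₂ _-_ (cong₂ ratio (eq (2 ℕ.+ k)) (eq (1 ℕ.+ k))) (cong₂ ratio (eq (1 ℕ.+ k)) (eq k))

mainTheorem1 : (a : ℕ → ℕ) → IsTriSqEnum a →
    ConvergesToL (λ j → qdiv (b a (j Data.Nat.∸ 1)) (b a j))
mainTheorem1 a enum ε 0<ε = threshold (archimedean (*-pos 0<ε 0<ε))
  where
  a≗triSq : ∀ i → a (suc i) ≡ triSq (suc i)
  a≗triSq = enumeration-triSq enum
  threshold : ∃[ K ] 1ℚ ≤ ε * ε * fromℕ K →
              ∃[ N ] (∀ j → N ℕ.≤ j → WithinOfL ε (qdiv (b a (j ℕ.∸ 1)) (b a j)))
  threshold (K , 1≤ε²K) = 3 ℕ.+ defectConstant ℕ.* K , λ where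
    (suc (suc (suc k))) (s≤s (s≤s (s≤s CK≤k))) →
      subst (WithinOfL ε) (sym (cong₂ qdiv (b-cong {a} {triSq} a≗triSq k) (b-cong {a} {triSq} a≗triSq (1 ℕ.+ k))))
            (within-of-scaled-root {r = qdiv (b triSq (2 ℕ.+ k)) (b triSq (3 ℕ.+ k))} {numer k} {denom k} {defect k} {K}
                                   0<ε 1≤ε²K (triSq-b-ratio k) (triSq-defect k) (numer-dominates k) (defect-small {K} k CK≤k))
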